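{- Let $p\ge 3$. Then $\mu_{\rm d}(S_p^2)=p$, and $S_p^2$ has exactly $p+1$ dual mutual-visibility sets of cardinality $p$.
   Context: For $p\ge 3$, $n\ge1$, the Sierpiński graph $S_p^n$ has vertex set $\{0,1,\dots,p-1\}^n$ (vertices written as words $i_1\cdots i_n$), and $i_1\cdots i_n$ is adjacent to $j_1\cdots j_n$ iff there is $h\in\{1,\dots,n\}$ with $i_t=j_t$ for all $t<h$, $i_h\ne j_h$, and $i_t=j_h$, $j_t=i_h$ for all $t>h$. For a graph $G$ and $X\subseteq V(G)$, vertices $u,v$ are $X$-visible if some shortest $u,v$-path $P$ satisfies $V(P)\cap X\subseteq\{u,v\}$. $X$ is a dual mutual-visibility set if any two vertices of $X$ are $X$-visible and any two vertices of $V(G)\setminus X$ are $X$-visible; $\mu_{\rm d}(G)$ is the maximum size of such a set. -}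

module Defs where

open import Data.Nat using (ℕ; zero; suc; _+_; _≤_; _<_)
open import Data.Fin using (Fin; toℕ)
open import Data.Vec using (Vec; []; _∷_; lookup)
open import Data.List using (List; []; _∷_; concatMap; map; filter; length; allFin)
open import Data.Bool using (Bool; true; false; T)
open import Data.Product using (Σ; ∃; _×_; _,_)
open import Data.Sum using (_⊎_)
open import Data.List.Relation.Unary.All using (All)
open import Relation.Binary.PropositionalEquality using (_≡_; _≢_)
open import Relation.Nullary.Decidable using (does)
open import Data.Bool.Properties using (T?)

-- Vertices of the Sierpinski graph S_p^n: words i₁⋯iₙ over {0,…,p-1}.
Word : ℕ → ℕ → Set
Word p n = Vec (Fin p) n

Adj : {p n : ℕ} → Word p n → Word p n → Set
Adj {p} {n} u v =
  Σ (Fin n) λ h →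
    (∀ (t : Fin n) → toℕ t < toℕ h → lookup u t ≡ lookup v t) ×
    (lookup u h ≢ lookup v h) ×
    (∀ (t : Fin n) → toℕ h < toℕ t →
       (lookup u t ≡ lookup v h) × (lookup v t ≡ lookup u h))

data Walk {p n : ℕ} : Word p n → Word p n → Set where
  stop : ∀ {u} → Walk u u
  step : ∀ {u w v} → Adj u w → Walk w v → Walk u v

len : ∀ {p n} {u v : Word p n} → Walk u v → ℕ
len stop       = zero
len (step _ q) = suc (len q)

verts : ∀ {p n} {u v : Word p n} → Walk u v → List (Word p n)
verts {u = u} stop       = u ∷ []
verts {u = u} (step _ q) = u ∷ verts q

Shortest : ∀ {p n} {u v : Word p n} → Walk u v → Set
Shortest {u = u} {v = v} P = ∀ (Q : Walk u v) → len P ≤ len Q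

VSet : ℕ → ℕ → Set
VSet p n = Word p n → Bool

Visible : ∀ {p n} → VSet p n → Word p n → Word p n → Set
Visible X u v =
  Σ (Walk u v) λ P → Shortest P ×
    All (λ w → X w ≡ true → (w ≡ u) ⊎ (w ≡ v)) (verts P)

DualMV : ∀ {p n} → VSet p n → Set
DualMV X =
  (∀ u v → X u ≡ true  → X v ≡ true  → Visible X u v) ×
  (∀ u v → X u ≡ false → X v ≡ false → Visible X u v)

allWords : (p n : ℕ) → List (Word p n)
allWords p zero    = [] ∷ []
allWords p (suc n) = concatMap (λ i → map (i ∷_) (allWords p n)) (allFin p)

card : ∀ {p n} → VSet p n → ℕ
card {p} {n} X = length (filter (λ w → T? (X w)) (allWords p n))

-- For i ≠ j the vertex ij is the only interior vertex common to all geodesics from ia (a ≠ j)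
-- to ji, and to all geodesics from ii to jj. Hence if a dual mutual-visibility set X contains
-- such a non-extreme vertex ij, each of these pairs has one end in X and one outside, which
-- forces X to be the whole copy iS_p^1. Otherwise X consists of extreme vertices ii only, so
-- |X| ≤ p, with equality exactly for the set of all extreme vertices. Conversely, the p copies
-- and the set of extreme vertices are dual mutual-visibility sets, because apart from its ends
-- a geodesic meets only the two ends of the bridge between the copies of its ends.

module Submission where

open import Defs
open import Data.Bool using (Bool; true; false; not; if_then_else_)
open import Data.Bool.Properties as Bool using (¬-not; T?)
open import Data.Fin using (Fin; zero; suc; punchIn; splitAt; join)
open import Data.Fin.Properties using (_≟_; any?; punchInᵢ≢i; splitAt-join; join-splitAt)
open import Data.List using (List; []; _∷_; _++_; length; filter; map; concatMap; tabulate)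
open import Data.List.Membership.Propositional using (_∈_)
open import Data.List.Membership.Propositional.Properties using (∈-concat⁺′; ∈-map⁺; ∈-allFin)
open import Data.List.Properties using (filter-++; length-++)
open import Data.List.Relation.Unary.All as All using (All; []; _∷_)
open import Data.List.Relation.Unary.Any using (here; there)
open import Data.Nat using (ℕ; zero; suc; _≤_; _+_; z≤n; s≤s)
open import Data.Nat.Properties
  using (≤-refl; ≤-trans; ≤-reflexive; ≤-antisym; +-monoˡ-≤; m≤m+n; m≤n⇒m≤1+n; <⇒≱; suc-injective;
         +-0-commutativeMonoid)
open import Algebra.Properties.CommutativeMonoid.Sum +-0-commutativeMonoid
  using (sum-syntax; sum-cong-≗; sum-remove; sum-replicate-zero; ∑-comm)
open import Data.Product using (Σ; _×_; _,_; proj₁; proj₂)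
open import Data.Sum using (_⊎_; inj₁; inj₂; [_,_]′)
open import Data.Vec using ([]; _∷_)
open import Function using (_∘_; id)
open import Function.Bundles using (mk⇔)
open import Relation.Binary.PropositionalEquality
  using (_≡_; _≢_; _≗_; refl; sym; trans; cong; cong₂; module ≡-Reasoning)
open import Relation.Nullary using (¬_; yes; no; does; contradiction)
open import Relation.Nullary.Decidable using (dec-true; dec-false; does-⇔; ¬?; _×-dec_)

pattern ⟨_,_⟩ i a = i ∷ a ∷ []

data Edge {p} : Word p 2 → Word p 2 → Set where
  inside : ∀ {i a b} → a ≢ b → Edge ⟨ i , a ⟩ ⟨ i , b ⟩
  bridge : ∀ {i j} → i ≢ j → Edge ⟨ i , j ⟩ ⟨ j , i ⟩

Adj⇒Edge : ∀ {p} {u v : Word p 2} → Adj u v → Edge u v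
Adj⇒Edge {u = ⟨ i , a ⟩} {⟨ j , b ⟩} (zero , _ , i≢j , after) with after (suc zero) (s≤s z≤n)
... | refl , refl = bridge i≢j
Adj⇒Edge {u = ⟨ i , a ⟩} {⟨ j , b ⟩} (suc zero , before , a≢b , _) with before zero (s≤s z≤n)
... | refl = inside a≢b

Edge⇒Adj : ∀ {p} {u v : Word p 2} → Edge u v → Adj u v
Edge⇒Adj (inside a≢b) =
  suc zero , (λ { zero _ → refl ; (suc zero) (s≤s ()) }) , a≢b , (λ { zero () ; (suc zero) (s≤s ()) })
Edge⇒Adj (bridge i≢j) =
  zero , (λ _ ()) , i≢j , (λ { (suc zero) _ → refl , refl ; zero () })

infixr 5 _∷ᵉ_
_∷ᵉ_ : ∀ {p} {u w v : Word p 2} → Edge u w → Walk w v → Walk u v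
e ∷ᵉ P = step (Edge⇒Adj e) P

δ : ∀ {p} → Fin p → Fin p → ℕ
δ a b = if does (a ≟ b) then 0 else 1

δ≤1 : ∀ {p} (a b : Fin p) → δ a b ≤ 1
δ≤1 a b with a ≟ b
... | yes _ = z≤n
... | no _  = ≤-refl

δ-refl : ∀ {p} (a : Fin p) → δ a a ≡ 0
δ-refl a = cong (if_then 0 else 1) (dec-true (a ≟ a) refl)

δ-sym : ∀ {p} (a b : Fin p) → δ a b ≡ δ b a
δ-sym a b = cong (if_then 0 else 1) (does-⇔ (mk⇔ sym sym) (a ≟ b) (b ≟ a))

-- A path between different copies iS_p^1 and jS_p^1 must use the bridge edge ij — ji.
dist : ∀ {p} → Word p 2 → Word p 2 → ℕ
dist ⟨ i , a ⟩ ⟨ j , b ⟩ = if does (i ≟ j) then δ a b else δ a j + suc (δ b i)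

dist-refl : ∀ {p} (u : Word p 2) → dist u u ≡ 0
dist-refl ⟨ i , a ⟩ with i ≟ i
... | yes _  = δ-refl a
... | no i≢i = contradiction refl i≢i

dist-edge : ∀ {p} {x y : Word p 2} → Edge x y → ∀ v → dist x v ≤ suc (dist y v)
dist-edge (inside {i} {a} _) ⟨ j , b ⟩ with i ≟ j
... | yes _ = ≤-trans (δ≤1 a b) (s≤s z≤n)
... | no _  = +-monoˡ-≤ (suc (δ b i)) (≤-trans (δ≤1 a j) (s≤s z≤n))
dist-edge (bridge {i} {k} _) ⟨ j , b ⟩ with i ≟ j
... | yes _ = ≤-trans (δ≤1 k b) (s≤s z≤n)
... | no _ with k ≟ j
...   | yes refl = ≤-reflexive (cong suc (δ-sym b i))
...   | no _     = ≤-trans (s≤s (s≤s (δ≤1 b i))) (m≤m+n 3 (δ b k))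

dist-≤-len : ∀ {p} {u v : Word p 2} (Q : Walk u v) → dist u v ≤ len Q
dist-≤-len {u = u} stop = ≤-reflexive (dist-refl u)
dist-≤-len {u = u} {v} (step {w = w} e Q) =
  ≤-trans (dist-edge (Adj⇒Edge {u = u} {w} e) v) (s≤s (dist-≤-len Q))

OnGeodesic : ∀ {p} → Word p 2 → Word p 2 → Word p 2 → Set
OnGeodesic ⟨ i , a ⟩ ⟨ j , b ⟩ w =
  w ≡ ⟨ i , a ⟩ ⊎ w ≡ ⟨ j , b ⟩ ⊎ (i ≢ j × (w ≡ ⟨ i , j ⟩ ⊎ w ≡ ⟨ j , i ⟩))

geodesic : ∀ {p} (u v : Word p 2) →
  Σ (Walk u v) λ P → len P ≤ dist u v × All (OnGeodesic u v) (verts P)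
geodesic ⟨ i , a ⟩ ⟨ j , b ⟩ with i ≟ j
... | yes refl with a ≟ b
...   | yes refl = stop , z≤n , inj₁ refl ∷ []
...   | no a≢b   = inside a≢b ∷ᵉ stop , ≤-refl , inj₁ refl ∷ inj₂ (inj₁ refl) ∷ []
geodesic ⟨ i , a ⟩ ⟨ j , b ⟩ | no i≢j with a ≟ j | b ≟ i
... | yes refl | yes refl =
  bridge i≢j ∷ᵉ stop , ≤-refl ,
  inj₁ refl ∷ inj₂ (inj₁ refl) ∷ []
... | yes refl | no b≢i =
  bridge i≢j ∷ᵉ inside (b≢i ∘ sym) ∷ᵉ stop , ≤-refl ,
  inj₁ refl ∷ inj₂ (inj₂ (i≢j , inj₂ refl)) ∷ inj₂ (inj₁ refl) ∷ []
... | no a≢j | yes refl =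
  inside a≢j ∷ᵉ bridge i≢j ∷ᵉ stop , ≤-refl ,
  inj₁ refl ∷ inj₂ (inj₂ (i≢j , inj₁ refl)) ∷ inj₂ (inj₁ refl) ∷ []
... | no a≢j | no b≢i =
  inside a≢j ∷ᵉ bridge i≢j ∷ᵉ inside (b≢i ∘ sym) ∷ᵉ stop , ≤-refl ,
  inj₁ refl ∷ inj₂ (inj₂ (i≢j , inj₁ refl)) ∷ inj₂ (inj₂ (i≢j , inj₂ refl)) ∷ inj₂ (inj₁ refl) ∷ []

visible-if-bridge-free : ∀ {p} (X : VSet p 2) (i a j b : Fin p) →
  (i ≢ j → X ⟨ i , j ⟩ ≡ false × X ⟨ j , i ⟩ ≡ false) → Visible X ⟨ i , a ⟩ ⟨ j , b ⟩
visible-if-bridge-free X i a j b bridge-free with geodesic ⟨ i , a ⟩ ⟨ j , b ⟩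
... | P , P≤dist , onP = P , (λ Q → ≤-trans P≤dist (dist-≤-len Q)) , All.map avoids onP
  where
  avoids : ∀ {w} → OnGeodesic ⟨ i , a ⟩ ⟨ j , b ⟩ w → X w ≡ true → w ≡ ⟨ i , a ⟩ ⊎ w ≡ ⟨ j , b ⟩
  avoids (inj₁ w≡u) _ = inj₁ w≡u
  avoids (inj₂ (inj₁ w≡v)) _ = inj₂ w≡v
  avoids (inj₂ (inj₂ (i≢j , inj₁ refl))) Xw = contradiction (trans (sym Xw) (proj₁ (bridge-free i≢j))) λ ()
  avoids (inj₂ (inj₂ (i≢j , inj₂ refl))) Xw = contradiction (trans (sym Xw) (proj₂ (bridge-free i≢j))) λ ()

extremes : ∀ {p} → VSet p 2
extremes ⟨ i , a ⟩ = does (a ≟ i)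

copy : ∀ {p} → Fin p → VSet p 2
copy c ⟨ i , _ ⟩ = does (i ≟ c)

extremes-dualMV : ∀ {p} → DualMV (extremes {p})
extremes-dualMV = (λ u v _ _ → visible u v) , (λ u v _ _ → visible u v)
  where
  visible : ∀ u v → Visible extremes u v
  visible ⟨ i , a ⟩ ⟨ j , b ⟩ = visible-if-bridge-free extremes i a j b
    λ i≢j → dec-false (j ≟ i) (i≢j ∘ sym) , dec-false (i ≟ j) i≢j

copy-dualMV : ∀ {p} (c : Fin p) → DualMV (copy c)
copy-dualMV c = inside-visible , outside-visible
  where
  inside-visible : ∀ u v → copy c u ≡ true → copy c v ≡ true → Visible (copy c) u v
  inside-visible ⟨ i , a ⟩ ⟨ j , b ⟩ _ _ with i ≟ c | j ≟ c
  inside-visible ⟨ i , a ⟩ ⟨ j , b ⟩ _  _  | yes refl | yes refl =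
    visible-if-bridge-free (copy i) i a i b λ i≢i → contradiction refl i≢i
  inside-visible ⟨ i , a ⟩ ⟨ j , b ⟩ () _  | no _     | _
  inside-visible ⟨ i , a ⟩ ⟨ j , b ⟩ _  () | yes _    | no _
  outside-visible : ∀ u v → copy c u ≡ false → copy c v ≡ false → Visible (copy c) u v
  outside-visible ⟨ i , a ⟩ ⟨ j , b ⟩ Xu Xv = visible-if-bridge-free (copy c) i a j b λ _ → Xu , Xv

DualMV⇒Visible : ∀ {p n} {X : VSet p n} → DualMV X → ∀ {u v} → X u ≡ X v → Visible X u v
DualMV⇒Visible {X = X} (inX , outX) {u} {v} Xu≡Xv with X u in Xu
... | true  = inX u v Xu (sym Xu≡Xv)
... | false = outX u v Xu (sym Xu≡Xv)

unavoidable⇒¬Visible : ∀ {p n} {X : VSet p n} {u v m : Word p n} (R : Walk u v) →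
  (∀ (P : Walk u v) → len P ≤ len R → m ∈ verts P) →
  X m ≡ true → m ≢ u → m ≢ v → ¬ Visible X u v
unavoidable⇒¬Visible R through Xm m≢u m≢v (P , shortest , avoids) =
  [ m≢u , m≢v ]′ (All.lookup avoids (through P (shortest R)) Xm)

short-walk-via-bridge : ∀ {p} {i a j : Fin p} → i ≢ j → a ≢ j →
  (P : Walk ⟨ i , a ⟩ ⟨ j , i ⟩) → len P ≤ 2 → ⟨ i , j ⟩ ∈ verts P
short-walk-via-bridge i≢j a≢j stop _ = contradiction refl i≢j
short-walk-via-bridge {i = i} {a} {j} i≢j a≢j (step e stop) _ with Adj⇒Edge {u = ⟨ i , a ⟩} {⟨ j , i ⟩} e
... | inside _ = contradiction refl i≢j
... | bridge _ = contradiction refl a≢j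
short-walk-via-bridge {i = i} {a} {j} i≢j a≢j (step {w = w} e (step e′ stop)) _
  with Adj⇒Edge {u = ⟨ i , a ⟩} {w} e | Adj⇒Edge {u = w} {⟨ j , i ⟩} e′
... | inside _ | inside _ = contradiction refl i≢j
... | inside _ | bridge _ = there (here refl)
... | bridge _ | inside _ = contradiction refl a≢j
... | bridge _ | bridge _ = contradiction refl i≢j
short-walk-via-bridge _ _ (step _ (step _ (step _ _))) (s≤s (s≤s ()))

extreme-walk-via-bridge : ∀ {p} {i j : Fin p} → i ≢ j →
  (P : Walk ⟨ i , i ⟩ ⟨ j , j ⟩) → len P ≤ 3 → ⟨ i , j ⟩ ∈ verts P
extreme-walk-via-bridge i≢j stop _ = contradiction refl i≢j
extreme-walk-via-bridge {i = i} {j} i≢j (step e stop) _ with Adj⇒Edge {u = ⟨ i , i ⟩} {⟨ j , j ⟩} e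
... | inside _ = contradiction refl i≢j
... | bridge i≢i = contradiction refl i≢i
extreme-walk-via-bridge {i = i} {j} i≢j (step {w = w} e (step e′ stop)) _
  with Adj⇒Edge {u = ⟨ i , i ⟩} {w} e | Adj⇒Edge {u = w} {⟨ j , j ⟩} e′
... | inside _ | inside _ = contradiction refl i≢j
... | inside _ | bridge _ = contradiction refl i≢j
... | bridge i≢i | _ = contradiction refl i≢i
extreme-walk-via-bridge {i = i} {j} i≢j (step {w = w} e (step {w = w′} e′ (step e″ stop))) _
  with Adj⇒Edge {u = ⟨ i , i ⟩} {w} e | Adj⇒Edge {u = w} {w′} e′ | Adj⇒Edge {u = w′} {⟨ j , j ⟩} e″
... | inside _ | bridge _ | inside _ = there (here refl)
... | inside _ | inside _ | inside _ = contradiction refl i≢j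
... | _ | _ | bridge j≢j = contradiction refl j≢j
... | bridge i≢i | _ | _ = contradiction refl i≢i
extreme-walk-via-bridge _ (step _ (step _ (step _ (step _ _)))) (s≤s (s≤s (s≤s ())))

_⊆_ : ∀ {A : Set} → (A → Bool) → (A → Bool) → Set
X ⊆ Y = ∀ x → X x ≡ true → Y x ≡ true

module _ {p} {X : VSet p 2} (dmv : DualMV X) where

  non-extreme-separates : ∀ {i j a} → i ≢ j → a ≢ j → X ⟨ i , j ⟩ ≡ true → X ⟨ i , a ⟩ ≢ X ⟨ j , i ⟩
  non-extreme-separates i≢j a≢j Xij Xia≡Xji =
    unavoidable⇒¬Visible (inside a≢j ∷ᵉ bridge i≢j ∷ᵉ stop) (short-walk-via-bridge i≢j a≢j)
      Xij (λ { refl → a≢j refl }) (λ { refl → i≢j refl }) (DualMV⇒Visible dmv Xia≡Xji)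

  non-extreme-separates-extremes : ∀ {i j} → i ≢ j → X ⟨ i , j ⟩ ≡ true → X ⟨ i , i ⟩ ≢ X ⟨ j , j ⟩
  non-extreme-separates-extremes i≢j Xij Xii≡Xjj =
    unavoidable⇒¬Visible (inside i≢j ∷ᵉ bridge i≢j ∷ᵉ inside i≢j ∷ᵉ stop) (extreme-walk-via-bridge i≢j)
      Xij (λ { refl → i≢j refl }) (λ { refl → i≢j refl }) (DualMV⇒Visible dmv Xii≡Xjj)

  bridge-ends-exclusive : ∀ {i j} → i ≢ j → X ⟨ i , j ⟩ ≡ true → X ⟨ j , i ⟩ ≡ false
  bridge-ends-exclusive {i} {j} i≢j Xij = ¬-not Xji≢true
    where
    -- Two of X(ii), X(jj) and X(ij) = X(ji) = true coincide, and each coincidence is excluded.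
    Xji≢true : X ⟨ j , i ⟩ ≢ true
    Xji≢true Xji with X ⟨ i , i ⟩ in Xii | X ⟨ j , j ⟩ in Xjj
    ... | true  | _     = non-extreme-separates i≢j i≢j Xij (trans Xii (sym Xji))
    ... | _     | true  = non-extreme-separates (i≢j ∘ sym) (i≢j ∘ sym) Xji (trans Xjj (sym Xij))
    ... | false | false = non-extreme-separates-extremes i≢j Xij (trans Xii (sym Xjj))

  copy-filled : ∀ {i j} → i ≢ j → X ⟨ i , j ⟩ ≡ true → ∀ a → X ⟨ i , a ⟩ ≡ true
  copy-filled {i} {j} i≢j Xij a with a ≟ j
  ... | yes refl = Xij
  ... | no a≢j   = begin
    X ⟨ i , a ⟩       ≡⟨ ¬-not (non-extreme-separates i≢j a≢j Xij) ⟩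
    not (X ⟨ j , i ⟩) ≡⟨ cong not (bridge-ends-exclusive i≢j Xij) ⟩
    true              ∎
    where open ≡-Reasoning

  other-copies-empty : ∀ {i j} → i ≢ j → X ⟨ i , j ⟩ ≡ true → ∀ {k} b → k ≢ i → X ⟨ k , b ⟩ ≡ false
  other-copies-empty {i} {j} i≢j Xij {k} b k≢i = ¬-not Xkb≢true
    where
    Xik : X ⟨ i , k ⟩ ≡ true
    Xik = copy-filled i≢j Xij k
    Xkb≢true : X ⟨ k , b ⟩ ≢ true
    Xkb≢true Xkb with b ≟ k
    ... | yes refl = non-extreme-separates-extremes (k≢i ∘ sym) Xik (trans (copy-filled i≢j Xij i) (sym Xkb))
    ... | no b≢k   = contradiction
      (trans (sym (copy-filled (b≢k ∘ sym) Xkb i)) (bridge-ends-exclusive (k≢i ∘ sym) Xik)) λ ()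

  classify : X ⊆ extremes ⊎ Σ (Fin p) λ c → X ≗ copy c
  classify with any? (λ i → any? (λ j → ¬? (i ≟ j) ×-dec (X ⟨ i , j ⟩ Bool.≟ true)))
  ... | yes (c , j , c≢j , Xcj) = inj₂ (c , filled)
    where
    filled : X ≗ copy c
    filled ⟨ i , a ⟩ with i ≟ c
    ... | yes refl = copy-filled c≢j Xcj a
    ... | no i≢c   = other-copies-empty c≢j Xcj a i≢c
  ... | no none = inj₁ only-extremes
    where
    only-extremes : X ⊆ extremes
    only-extremes ⟨ i , a ⟩ Xia with a ≟ i
    ... | yes _  = refl
    ... | no a≢i = contradiction (i , a , a≢i ∘ sym , Xia) none

count : ∀ {A : Set} → (A → Bool) → List A → ℕ
count X xs = length (filter (T? ∘ X) xs)

module _ {A : Set} {X Y : A → Bool} (X⊆Y : X ⊆ Y) where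

  count-mono : ∀ xs → count X xs ≤ count Y xs
  count-mono [] = z≤n
  count-mono (x ∷ xs) with X x in Xx | Y x in Yx
  ... | true  | true  = s≤s (count-mono xs)
  ... | true  | false = contradiction (trans (sym (X⊆Y x Xx)) Yx) λ ()
  ... | false | true  = m≤n⇒m≤1+n (count-mono xs)
  ... | false | false = count-mono xs

  count-saturated : ∀ {x xs} → count X xs ≡ count Y xs → x ∈ xs → Y x ≡ true → X x ≡ true
  count-saturated {_} {y ∷ ys} eq x∈ Yx with X y in Xy | Y y in Yy
  ... | true  | false = contradiction (trans (sym (X⊆Y y Xy)) Yy) λ ()
  ... | false | true  = contradiction (≤-reflexive (sym eq)) (<⇒≱ (s≤s (count-mono ys)))
  count-saturated eq (here refl) Yx | true  | true  = Xy
  count-saturated eq (there x∈) Yx | true  | true  = count-saturated (suc-injective eq) x∈ Yx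
  count-saturated eq (here refl) Yx | false | false = contradiction (trans (sym Yx) Yy) λ ()
  count-saturated eq (there x∈) Yx | false | false = count-saturated eq x∈ Yx

count-++ : ∀ {A : Set} (X : A → Bool) xs ys → count X (xs ++ ys) ≡ count X xs + count X ys
count-++ X xs ys = trans (cong length (filter-++ (T? ∘ X) xs ys)) (length-++ (filter (T? ∘ X) xs))

count-map : ∀ {A B : Set} (X : B → Bool) (f : A → B) xs → count X (map f xs) ≡ count (X ∘ f) xs
count-map X f [] = refl
count-map X f (x ∷ xs) with X (f x)
... | true  = cong suc (count-map X f xs)
... | false = count-map X f xs

count-concatMap : ∀ {A B : Set} (X : B → Bool) (F : A → List B) {m} (g : Fin m → A) →
  count X (concatMap F (tabulate g)) ≡ ∑[ i < m ] count X (F (g i))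
count-concatMap X F {zero} g = refl
count-concatMap X F {suc m} g =
  trans (count-++ X (F (g zero)) _) (cong (count X (F (g zero)) +_) (count-concatMap X F (g ∘ suc)))

card-∷ : ∀ {p n} (X : VSet p (suc n)) → card X ≡ ∑[ i < p ] card (X ∘ (i ∷_))
card-∷ {p} {n} X = trans (count-concatMap X (λ i → map (i ∷_) (allWords p n)) id)
  (sum-cong-≗ (λ i → count-map X (i ∷_) (allWords p n)))

∈-allWords : ∀ {p n} (w : Word p n) → w ∈ allWords p n
∈-allWords [] = here refl
∈-allWords {p} {suc n} (i ∷ w) =
  ∈-concat⁺′ (∈-map⁺ (i ∷_) (∈-allWords w)) (∈-map⁺ (λ k → map (k ∷_) (allWords p n)) (∈-allFin i))

𝟙 : Bool → ℕ
𝟙 b = if b then 1 else 0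

card-[] : ∀ {p} (X : VSet p 0) → card X ≡ 𝟙 (X [])
card-[] X with X []
... | true  = refl
... | false = refl

card-2 : ∀ {p} (X : VSet p 2) → card X ≡ ∑[ i < p ] ∑[ a < p ] 𝟙 (X ⟨ i , a ⟩)
card-2 X = trans (card-∷ X) (sum-cong-≗ λ i → trans (card-∷ (X ∘ (i ∷_)))
  (sum-cong-≗ λ a → card-[] (X ∘ (i ∷_) ∘ (a ∷_))))

∑-ones : ∀ n → ∑[ i < n ] 1 ≡ n
∑-ones zero    = refl
∑-ones (suc n) = cong suc (∑-ones n)

∑-point : ∀ {n} (c : Fin n) → ∑[ a < n ] 𝟙 (does (a ≟ c)) ≡ 1
∑-point {suc n} c = begin
  ∑[ a < suc n ] 𝟙 (does (a ≟ c))                       ≡⟨ sum-remove {i = c} (λ a → 𝟙 (does (a ≟ c))) ⟩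
  𝟙 (does (c ≟ c)) + ∑[ j < n ] 𝟙 (does (punchIn c j ≟ c)) ≡⟨ cong₂ _+_ (cong 𝟙 (dec-true (c ≟ c) refl))
                                                              (sum-cong-≗ λ j → cong 𝟙 (dec-false (punchIn c j ≟ c) (punchInᵢ≢i c j))) ⟩
  1 + ∑[ j < n ] 0                                      ≡⟨ cong suc (sum-replicate-zero n) ⟩
  1                                                     ∎
  where open ≡-Reasoning

module _ {p n} {X Y : VSet p n} (X⊆Y : X ⊆ Y) where

  card-mono : card X ≤ card Y
  card-mono = count-mono X⊆Y (allWords p n)

  card-saturated : card X ≡ card Y → Y ⊆ X
  card-saturated eq w = count-saturated X⊆Y eq (∈-allWords w)

⊆-antisym : ∀ {p n} {X Y : VSet p n} → X ⊆ Y → Y ⊆ X → X ≗ Y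
⊆-antisym {X = X} X⊆Y Y⊆X w with X w in Xw
... | true  = sym (X⊆Y w Xw)
... | false = sym (¬-not λ Yw → contradiction (trans (sym (Y⊆X w Yw)) Xw) λ ())

card-cong : ∀ {p n} {X Y : VSet p n} → X ≗ Y → card X ≡ card Y
card-cong X≗Y = ≤-antisym (card-mono (λ w Xw → trans (sym (X≗Y w)) Xw)) (card-mono (λ w Yw → trans (X≗Y w) Yw))

card-extremes : ∀ {p} → card (extremes {p}) ≡ p
card-extremes {p} = begin
  card (extremes {p})                        ≡⟨ card-2 (extremes {p}) ⟩
  ∑[ i < p ] ∑[ a < p ] 𝟙 (does (a ≟ i))     ≡⟨ sum-cong-≗ {p} ∑-point ⟩
  ∑[ i < p ] 1                               ≡⟨ ∑-ones p ⟩
  p                                          ∎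
  where open ≡-Reasoning

card-copy : ∀ {p} (c : Fin p) → card (copy c) ≡ p
card-copy {p} c = begin
  card (copy c)                              ≡⟨ card-2 (copy c) ⟩
  ∑[ i < p ] ∑[ a < p ] 𝟙 (does (i ≟ c))     ≡⟨ ∑-comm (λ i (_ : Fin p) → 𝟙 (does (i ≟ c))) ⟩
  ∑[ a < p ] ∑[ i < p ] 𝟙 (does (i ≟ c))     ≡⟨ sum-cong-≗ {p} (λ _ → ∑-point c) ⟩
  ∑[ a < p ] 1                               ≡⟨ ∑-ones p ⟩
  p                                          ∎
  where open ≡-Reasoning

does-≟⇒≡ : ∀ {p} {a b : Fin p} → does (a ≟ b) ≡ true → a ≡ b
does-≟⇒≡ {a = a} {b} eq with a ≟ b
... | yes a≡b = a≡b

copy≗extremes⇒trivial : ∀ {p} {c : Fin p} → copy c ≗ extremes → ∀ o → o ≡ c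
copy≗extremes⇒trivial same o = does-≟⇒≡ (trans (same ⟨ o , o ⟩) (dec-true (o ≟ o) refl))

copy-injective : ∀ {p} {c d : Fin p} → copy c ≗ copy d → c ≡ d
copy-injective {c = c} same = does-≟⇒≡ (trans (sym (same ⟨ c , c ⟩)) (dec-true (c ≟ c) refl))

candidate : ∀ {p} → Fin p ⊎ Fin 1 → VSet p 2
candidate = [ copy , (λ _ → extremes) ]′

candidate-injective : ∀ {m} {x y : Fin (2 + m) ⊎ Fin 1} → candidate x ≗ candidate y → x ≡ y
candidate-injective {x = inj₁ c} {inj₁ d} same = cong inj₁ (copy-injective same)
candidate-injective {x = inj₁ c} {inj₂ _} same =
  contradiction (trans (copy≗extremes⇒trivial same zero) (sym (copy≗extremes⇒trivial same (suc zero)))) λ ()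
candidate-injective {x = inj₂ _} {inj₁ d} same =
  contradiction (trans (copy≗extremes⇒trivial (sym ∘ same) zero) (sym (copy≗extremes⇒trivial (sym ∘ same) (suc zero)))) λ ()
candidate-injective {x = inj₂ zero} {inj₂ zero} _ = refl

candidate-dualMV : ∀ {p} (x : Fin p ⊎ Fin 1) → DualMV (candidate x) × card (candidate x) ≡ p
candidate-dualMV (inj₁ c) = copy-dualMV c , card-copy c
candidate-dualMV (inj₂ _) = extremes-dualMV , card-extremes

module _ {p} {X : VSet p 2} (dmv : DualMV X) where

  dualMV-card-≤ : card X ≤ p
  dualMV-card-≤ with classify dmv
  ... | inj₁ X⊆extremes  = ≤-trans (card-mono X⊆extremes) (≤-reflexive card-extremes)
  ... | inj₂ (c , X≗copy) = ≤-reflexive (trans (card-cong X≗copy) (card-copy c))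

  dualMV-card-≡ : card X ≡ p → Σ (Fin p ⊎ Fin 1) λ x → X ≗ candidate x
  dualMV-card-≡ |X|≡p with classify dmv
  ... | inj₁ X⊆extremes  = inj₂ zero , ⊆-antisym X⊆extremes (card-saturated X⊆extremes (trans |X|≡p (sym card-extremes)))
  ... | inj₂ (c , X≗copy) = inj₁ c , X≗copy

theorem3p3 : (p : ℕ) → 3 ≤ p →
    ((X : VSet p 2) → DualMV X → card X ≤ p) ×
    (Σ (VSet p 2) λ X → DualMV X × card X ≡ p) ×
    (Σ (Fin (p + 1) → VSet p 2) λ S →
      ((i : Fin (p + 1)) → DualMV (S i) × card (S i) ≡ p) ×
      ((i j : Fin (p + 1)) → ((w : Word p 2) → S i w ≡ S j w) → i ≡ j) ×
      ((X : VSet p 2) → DualMV X → card X ≡ p →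
        Σ (Fin (p + 1)) λ i → (w : Word p 2) → X w ≡ S i w))
theorem3p3 p@(suc (suc _)) (s≤s (s≤s _)) =
  (λ _ → dualMV-card-≤) ,
  (extremes , extremes-dualMV , card-extremes) ,
  (candidate ∘ splitAt p , candidate-dualMV ∘ splitAt p , injective , complete)
  where
  injective : ∀ i j → candidate (splitAt p i) ≗ candidate (splitAt p j) → i ≡ j
  injective i j same = begin
    i                     ≡⟨ join-splitAt p 1 i ⟨
    join p 1 (splitAt p i) ≡⟨ cong (join p 1) (candidate-injective {x = splitAt p i} {splitAt p j} same) ⟩
    join p 1 (splitAt p j) ≡⟨ join-splitAt p 1 j ⟩
    j                     ∎
    where open ≡-Reasoning

  complete : ∀ X → DualMV X → card X ≡ p → Σ (Fin (p + 1)) λ i → X ≗ candidate (splitAt p i)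
  complete X dmv |X|≡p with dualMV-card-≡ dmv |X|≡p
  ... | x , X≗candidate = join p 1 x , λ w → trans (X≗candidate w) (cong (λ y → candidate y w) (sym (splitAt-join p 1 x)))
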